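{- Let $G$ be a graph and let $c$ and $c'$ be two charge functions such that $T(G,c)$ and $T(G,c')$ are satisfiable Tseitin-formulas. Then $T(G,c)$ can be computed by a DNNF of size $s$ if and only if $T(G,c')$ can be computed by a DNNF of size $s$.
   Context: For $v\in V(G)$, $E(v)$ is the set of edges incident to $v$. For a charge function $c:V(G)\to\{0,1\}$, the Tseitin-formula $T(G,c)$ has variables $x_e$ ($e\in E(G)$) and is the conjunction over $v\in V(G)$ of the constraints $\sum_{e\in E(v)}x_e\equiv c(v)\pmod 2$. A DNNF over variables $X$ is a DAG circuit whose leaves are literals over $X$ or constants $0/1$ and whose internal nodes are binary $\land$- and $\lor$-gates, such that the two inputs of every $\land$-gate contain disjoint sets of variables; its size is its number of gates. -}

module Defs where

open import Data.Nat using (ℕ; zero; suc)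
open import Data.Fin using (Fin; zero; suc; _≟_)
open import Data.Bool using (Bool; true; false; _∧_; _∨_; _xor_; not; if_then_else_)
open import Data.List using (List; foldr; allFin)
open import Data.Product using (_×_; _,_; proj₁; proj₂; ∃)
open import Data.Sum using (_⊎_)
open import Data.Unit using (⊤)
open import Data.Empty using (⊥)
open import Relation.Nullary using (¬_)
open import Relation.Nullary.Decidable using (⌊_⌋)
open import Relation.Binary.PropositionalEquality using (_≡_)

record Graph : Set where
  field
    n      : ℕ
    m      : ℕ
    ends   : Fin m → Fin n × Fin n
    loopless : ∀ e → ¬ (proj₁ (ends e) ≡ proj₂ (ends e))
    simple : ∀ e f →
      ((proj₁ (ends e) ≡ proj₁ (ends f)) × (proj₂ (ends e) ≡ proj₂ (ends f))) ⊎
      ((proj₁ (ends e) ≡ proj₂ (ends f)) × (proj₂ (ends e) ≡ proj₁ (ends f))) →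
      e ≡ f

open Graph public

incident : (G : Graph) → Fin (n G) → Fin (m G) → Bool
incident G v e = ⌊ proj₁ (ends G e) ≟ v ⌋ ∨ ⌊ proj₂ (ends G e) ≟ v ⌋

Charge : Graph → Set
Charge G = Fin (n G) → Bool

Assignment : ℕ → Set
Assignment m = Fin m → Bool

parity : List Bool → Bool
parity = foldr _xor_ false

vertexSum : (G : Graph) → Assignment (m G) → Fin (n G) → Bool
vertexSum G x v = parity (Data.List.map (λ e → incident G v e ∧ x e) (allFin (m G)))

tseitin : (G : Graph) → Charge G → Assignment (m G) → Bool
tseitin G c x =
  foldr _∧_ true
    (Data.List.map (λ v → not (vertexSum G x v xor c v)) (allFin (n G)))

Satisfiable : (G : Graph) → Charge G → Set
Satisfiable G c = ∃ λ x → tseitin G c x ≡ true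

-- A circuit with k gates over variables Fin m is a
-- sequence of gates; each gate's two inputs are leaves (literals or
-- constants) or earlier gates (de Bruijn: `gate zero` = the most recent
-- earlier gate).

data Leaf (m : ℕ) : Set where
  lit   : Fin m → Bool → Leaf m
  const : Bool → Leaf m

data Inp (m k : ℕ) : Set where
  leaf : Leaf m → Inp m k
  gate : Fin k → Inp m k

data Op : Set where
  AND OR : Op

Gate : ℕ → ℕ → Set
Gate m k = Op × Inp m k × Inp m k

data Circ (m : ℕ) : ℕ → Set where
  []  : Circ m zero
  _▷_ : ∀ {k} → Circ m k → Gate m k → Circ m (suc k)

evalLeaf : ∀ {m} → Assignment m → Leaf m → Bool
evalLeaf x (lit y true)  = x y
evalLeaf x (lit y false) = not (x y)
evalLeaf x (const b)     = b

evalOp : Op → Bool → Bool → Bool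
evalOp AND a b = a ∧ b
evalOp OR  a b = a ∨ b

evalI : ∀ {m k} → Circ m k → Assignment m → Inp m k → Bool
evalI C x (leaf l) = evalLeaf x l
evalI (C ▷ (o , a , b)) x (gate zero) = evalOp o (evalI C x a) (evalI C x b)
evalI (C ▷ g) x (gate (suc j)) = evalI C x (gate j)

occLeaf : ∀ {m} → Leaf m → Fin m → Bool
occLeaf (lit z _) y = ⌊ z ≟ y ⌋
occLeaf (const _) y = false

occI : ∀ {m k} → Circ m k → Inp m k → Fin m → Bool
occI C (leaf l) y = occLeaf l y
occI (C ▷ (o , a , b)) (gate zero) y = occI C a y ∨ occI C b y
occI (C ▷ g) (gate (suc j)) y = occI C (gate j) y

Decomposable : ∀ {m k} → Circ m k → Set
Decomposable [] = ⊤
Decomposable (C ▷ (AND , a , b)) =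
  Decomposable C × (∀ y → occI C a y ∧ occI C b y ≡ false)
Decomposable (C ▷ (OR , a , b)) = Decomposable C

record DNNF (m s : ℕ) : Set where
  field
    circ   : Circ m s
    out    : Inp m s
    decomp : Decomposable circ

evalDNNF : ∀ {m s} → DNNF m s → Assignment m → Bool
evalDNNF D x = evalI (DNNF.circ D) x (DNNF.out D)

ComputableBySize : (m s : ℕ) → (Assignment m → Bool) → Set
ComputableBySize m s f = ∃ λ (D : DNNF m s) → ∀ x → evalDNNF D x ≡ f x

-- The solutions of a satisfiable Tseitin formula T(G,c) form a coset a + K of the
-- cycle space K (the kernel of the mod-2 incidence map x ↦ vertexSum G x). Hence, for
-- solutions a of T(G,c) and a' of T(G,c'), x satisfies T(G,c') iff x ⊕ a ⊕ a' satisfies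
-- T(G,c). Substituting x_e ⊕ d_e for x_e in a DNNF only flips the polarity of literals,
-- which changes neither the gates nor the variables below them, so size and
-- decomposability are preserved.
module Submission where

open import Defs
open import Algebra.Bundles using (CommutativeRing)
open import Data.Bool using (Bool; true; false; _∧_; _∨_; _xor_; not)
open import Data.Bool.Properties
  using (xor-∧-commutativeRing; xor-assoc; xor-comm; xor-same; ∧-distribˡ-xor; not-involutive)
open import Algebra.Properties.CommutativeSemigroup
  (CommutativeRing.+-commutativeSemigroup xor-∧-commutativeRing) using (interchange)
open import Data.Fin using (Fin; zero; suc)
open import Data.Bool.ListAction using (and)
open import Data.List using (List; []; _∷_; map; allFin)
open import Data.List.Properties using (map-cong)
open import Data.List.Membership.Propositional using (_∈_)
open import Data.List.Membership.Propositional.Properties using (∈-allFin)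
open import Data.List.Relation.Unary.Any using (here; there)
open import Data.Nat using (ℕ)
open import Data.Product using (_×_; _,_)
open import Relation.Binary.PropositionalEquality

infixl 6 _⊕_

_⊕_ : ∀ {m} → Assignment m → Assignment m → Assignment m
(x ⊕ y) e = x e xor y e

not-xor≡true⇒≡ : ∀ a b → not (a xor b) ≡ true → a ≡ b
not-xor≡true⇒≡ false false _ = refl
not-xor≡true⇒≡ true  true  _ = refl

xor-cancelʳ : ∀ a b c → (a xor (b xor c)) xor b ≡ a xor c
xor-cancelʳ a b c = begin
  (a xor (b xor c)) xor b  ≡⟨ xor-assoc a (b xor c) b ⟩
  a xor ((b xor c) xor b)  ≡⟨ cong (a xor_) (xor-comm (b xor c) b) ⟩
  a xor (b xor (b xor c))  ≡⟨ cong (a xor_) (sym (xor-assoc b b c)) ⟩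
  a xor ((b xor b) xor c)  ≡⟨ cong (λ z → a xor (z xor c)) (xor-same b) ⟩
  a xor c                  ∎
  where open ≡-Reasoning

and-map≡true⇒∈⇒≡true : ∀ {A : Set} (f : A → Bool) {xs : List A} →
  and (map f xs) ≡ true → ∀ {v} → v ∈ xs → f v ≡ true
and-map≡true⇒∈⇒≡true f {a ∷ xs} p (here refl) with f a
... | true = refl
and-map≡true⇒∈⇒≡true f {a ∷ xs} p (there v∈xs) with f a
... | true = and-map≡true⇒∈⇒≡true f p v∈xs

parity-map-xor : ∀ {A : Set} (f g : A → Bool) (xs : List A) →
  parity (map (λ a → f a xor g a) xs) ≡ parity (map f xs) xor parity (map g xs)
parity-map-xor f g []       = refl
parity-map-xor f g (a ∷ xs) =
  trans (cong ((f a xor g a) xor_) (parity-map-xor f g xs))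
        (interchange (f a) (g a) (parity (map f xs)) (parity (map g xs)))

vertexSum-⊕ : (G : Graph) (x y : Assignment (m G)) (v : Fin (n G)) →
  vertexSum G (x ⊕ y) v ≡ vertexSum G x v xor vertexSum G y v
vertexSum-⊕ G x y v = begin
  parity (map (λ e → incident G v e ∧ (x e xor y e)) (allFin (m G)))
    ≡⟨ cong parity (map-cong (λ e → ∧-distribˡ-xor (incident G v e) (x e) (y e)) (allFin (m G))) ⟩
  parity (map (λ e → (incident G v e ∧ x e) xor (incident G v e ∧ y e)) (allFin (m G)))
    ≡⟨ parity-map-xor (λ e → incident G v e ∧ x e) (λ e → incident G v e ∧ y e) (allFin (m G)) ⟩
  vertexSum G x v xor vertexSum G y v
    ∎
  where open ≡-Reasoning

tseitin≡true⇒vertexSum≡charge : (G : Graph) (c : Charge G) (a : Assignment (m G)) →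
  tseitin G c a ≡ true → ∀ v → vertexSum G a v ≡ c v
tseitin≡true⇒vertexSum≡charge G c a p v =
  not-xor≡true⇒≡ _ _
    (and-map≡true⇒∈⇒≡true (λ v → not (vertexSum G a v xor c v)) p (∈-allFin v))

tseitin-translate : (G : Graph) (c c' : Charge G) (a a' : Assignment (m G)) →
  tseitin G c a ≡ true → tseitin G c' a' ≡ true →
  ∀ x → tseitin G c' x ≡ tseitin G c (x ⊕ (a ⊕ a'))
tseitin-translate G c c' a a' sat sat' x =
  sym (cong and (map-cong constraint (allFin (n G))))
  where
  constraint : ∀ v → not (vertexSum G (x ⊕ (a ⊕ a')) v xor c v) ≡ not (vertexSum G x v xor c' v)
  constraint v = cong not (begin
    vertexSum G (x ⊕ (a ⊕ a')) v xor c v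
      ≡⟨ cong (_xor c v) (vertexSum-⊕ G x (a ⊕ a') v) ⟩
    (vertexSum G x v xor vertexSum G (a ⊕ a') v) xor c v
      ≡⟨ cong (λ z → (vertexSum G x v xor z) xor c v) (vertexSum-⊕ G a a' v) ⟩
    (vertexSum G x v xor (vertexSum G a v xor vertexSum G a' v)) xor c v
      ≡⟨ cong₂ (λ z z' → (vertexSum G x v xor (z xor z')) xor c v)
               (tseitin≡true⇒vertexSum≡charge G c a sat v)
               (tseitin≡true⇒vertexSum≡charge G c' a' sat' v) ⟩
    (vertexSum G x v xor (c v xor c' v)) xor c v
      ≡⟨ xor-cancelʳ (vertexSum G x v) (c v) (c' v) ⟩
    vertexSum G x v xor c' v
      ∎)
    where open ≡-Reasoning

evalLeaf-lit : ∀ {m} (x : Assignment m) y b → evalLeaf x (lit y b) ≡ not (b xor x y)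
evalLeaf-lit x y true  = sym (not-involutive (x y))
evalLeaf-lit x y false = refl

module Translate {m : ℕ} (d : Assignment m) where

  flipLeaf : Leaf m → Leaf m
  flipLeaf (lit y b) = lit y (b xor d y)
  flipLeaf (const b) = const b

  flipInp : ∀ {k} → Inp m k → Inp m k
  flipInp (leaf l) = leaf (flipLeaf l)
  flipInp (gate j) = gate j

  flipCirc : ∀ {k} → Circ m k → Circ m k
  flipCirc []                = []
  flipCirc (C ▷ (o , a , b)) = flipCirc C ▷ (o , flipInp a , flipInp b)

  evalLeaf-flip : ∀ x l → evalLeaf x (flipLeaf l) ≡ evalLeaf (x ⊕ d) l
  evalLeaf-flip x (const b) = refl
  evalLeaf-flip x (lit y b) = begin
    evalLeaf x (lit y (b xor d y))  ≡⟨ evalLeaf-lit x y (b xor d y) ⟩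
    not ((b xor d y) xor x y)       ≡⟨ cong not (xor-assoc b (d y) (x y)) ⟩
    not (b xor (d y xor x y))       ≡⟨ cong (λ z → not (b xor z)) (xor-comm (d y) (x y)) ⟩
    not (b xor (x y xor d y))       ≡⟨ sym (evalLeaf-lit (x ⊕ d) y b) ⟩
    evalLeaf (x ⊕ d) (lit y b)      ∎
    where open ≡-Reasoning

  evalI-flip : ∀ {k} (C : Circ m k) x i → evalI (flipCirc C) x (flipInp i) ≡ evalI C (x ⊕ d) i
  evalI-flip C                 x (leaf l)       = evalLeaf-flip x l
  evalI-flip (C ▷ (o , a , b)) x (gate zero)    =
    cong₂ (evalOp o) (evalI-flip C x a) (evalI-flip C x b)
  evalI-flip (C ▷ _)           x (gate (suc j)) = evalI-flip C x (gate j)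

  occLeaf-flip : ∀ l y → occLeaf (flipLeaf l) y ≡ occLeaf l y
  occLeaf-flip (lit z b) y = refl
  occLeaf-flip (const b) y = refl

  occI-flip : ∀ {k} (C : Circ m k) i y → occI (flipCirc C) (flipInp i) y ≡ occI C i y
  occI-flip C                 (leaf l)       y = occLeaf-flip l y
  occI-flip (C ▷ (o , a , b)) (gate zero)    y = cong₂ _∨_ (occI-flip C a y) (occI-flip C b y)
  occI-flip (C ▷ _)           (gate (suc j)) y = occI-flip C (gate j) y

  flipCirc-decomposable : ∀ {k} (C : Circ m k) → Decomposable C → Decomposable (flipCirc C)
  flipCirc-decomposable []                  _           = _
  flipCirc-decomposable (C ▷ (AND , a , b)) (dC , disj) =
    flipCirc-decomposable C dC ,
    λ y → trans (cong₂ _∧_ (occI-flip C a y) (occI-flip C b y)) (disj y)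
  flipCirc-decomposable (C ▷ (OR , a , b))  dC          = flipCirc-decomposable C dC

  flipDNNF : ∀ {s} → DNNF m s → DNNF m s
  flipDNNF D = record
    { circ   = flipCirc (DNNF.circ D)
    ; out    = flipInp (DNNF.out D)
    ; decomp = flipCirc-decomposable (DNNF.circ D) (DNNF.decomp D)
    }

  evalDNNF-flip : ∀ {s} (D : DNNF m s) x → evalDNNF (flipDNNF D) x ≡ evalDNNF D (x ⊕ d)
  evalDNNF-flip D x = evalI-flip (DNNF.circ D) x (DNNF.out D)

open Translate using (flipDNNF; evalDNNF-flip)

computable-translate : ∀ {m s} (f g : Assignment m → Bool) (d : Assignment m) →
  (∀ x → g x ≡ f (x ⊕ d)) → ComputableBySize m s f → ComputableBySize m s g
computable-translate f g d g≡f∘⊕d (D , D≡f) =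
  flipDNNF d D , λ x → trans (evalDNNF-flip d D x) (trans (D≡f (x ⊕ d)) (sym (g≡f∘⊕d x)))

lemma2 : (G : Graph) (c c' : Charge G) (s : ℕ) →
    Satisfiable G c → Satisfiable G c' →
    (ComputableBySize (m G) s (tseitin G c) → ComputableBySize (m G) s (tseitin G c')) ×
    (ComputableBySize (m G) s (tseitin G c') → ComputableBySize (m G) s (tseitin G c))
lemma2 G c c' s (a , sat) (a' , sat') =
  computable-translate _ _ (a ⊕ a') (tseitin-translate G c c' a a' sat sat') ,
  computable-translate _ _ (a' ⊕ a) (tseitin-translate G c' c a' a sat' sat)
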